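{- Let $c\in\mathbb{N}$ and let $\lambda,\mu,\pi$ be partitions with $\mathrm{ht}(\lambda),\mathrm{ht}(\mu),\mathrm{ht}(\pi)\le c$ and $|\lambda|=|\mu|=|\pi|\ge(c+2)c$. Then $t^\lambda_{\mu,\pi}>0$.
   Context: $\mathrm{ht}(\alpha)$ is the number of nonzero parts of $\alpha$, $\alpha^T$ its vector of column lengths. For finite $P\subseteq\mathbb{N}^3$ the marginals are $(x_P,y_P,z_P)$ with $x_P(i)$ the number of points of $P$ with $x$-coordinate $i$, etc.; $t^\lambda_{\mu,\pi}$ is the number of finite $P\subseteq\mathbb{N}^3$ with marginals $(\lambda^T,\mu^T,\pi^T)$. -}

module Defs where

open import Data.Nat using (ℕ; zero; suc; _+_; _*_; _≤_; _<_; _≥_; _≟_; _<?_)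
open import Data.List using (List; []; _∷_; length; filter)
open import Data.Nat.ListAction using (sum)
open import Data.List.Relation.Unary.All using (All)
open import Data.List.Relation.Unary.Linked using (Linked)
open import Data.List.Relation.Unary.Unique.Propositional using (Unique)
open import Data.Product using (_×_; _,_; proj₁; proj₂; ∃)
open import Relation.Binary.PropositionalEquality using (_≡_)

record Partition : Set where
  constructor mkPartition
  field
    parts    : List ℕ
    decr     : Linked _≥_ parts
    positive : All (λ k → 0 < k) parts
open Partition public

ht : Partition → ℕ
ht α = length (parts α)

∣_∣ₚ : Partition → ℕ
∣ α ∣ₚ = sum (parts α)

-- α^T as an infinite, finitely supported sequence (0-indexed):
-- α^T(j) = #{ i : α_i > j }  (column lengths, zero beyond α_1)
transpose : Partition → ℕ → ℕ
transpose α j = length (filter (λ k → j <? k) (parts α))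

Point : Set
Point = ℕ × ℕ × ℕ

px py pz : Point → ℕ
px (x , _ , _) = x
py (_ , y , _) = y
pz (_ , _ , z) = z

-- A finite subset P ⊆ ℕ³ is represented by a duplicate-free list.
-- Marginals: x_P(i) = #{p ∈ P : x-coordinate of p is i}, etc.
xMarg yMarg zMarg : List Point → ℕ → ℕ
xMarg P i = length (filter (λ p → px p ≟ i) P)
yMarg P i = length (filter (λ p → py p ≟ i) P)
zMarg P i = length (filter (λ p → pz p ≟ i) P)

HasMarginals : List Point → Partition → Partition → Partition → Set
HasMarginals P λ' μ π =
  (∀ i → xMarg P i ≡ transpose λ' i) ×
  (∀ i → yMarg P i ≡ transpose μ i) ×
  (∀ i → zMarg P i ≡ transpose π i)

tPositive : Partition → Partition → Partition → Set
tPositive λ' μ π = ∃ λ (P : List Point) → Unique P × HasMarginals P λ' μ π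

module Submission where

-- Let c bound the heights and n be the common size of λ, μ, π.  A partition α
-- is encoded by its column word w_α = 0^{α^T(0)} 1^{α^T(1)} 2^{α^T(2)} …, a
-- weakly increasing word of length n in which the letter j occurs α^T(j)
-- times.  Since α^T(j) ≤ ht α ≤ c, equal letters of w_α sit less than c
-- positions apart ("w_α is c-sparse").  Next, deal the positions 0 … n-1 into
-- c piles (pile r holds r, r + c, r + 2c, …) and concatenate the piles; when
-- every pile has more than c cards, which (c + 2) c ≤ n guarantees, this
-- permutation φ sends positions less than c apart to values at least c apart.
-- The point set P = { (w_λ(φ p), w_μ(p), w_π(p)) : p < n } then has marginals
-- (λ^T, μ^T, π^T), because its three coordinate lists are rearrangements of
-- the three column words; and no point repeats: equal μ-letters force p and q
-- to be close, and then equal λ-letters would force φ p and φ q to be close.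

open import Function using (_∘_; id; case_of_)
open import Data.Bool using (true; false)
open import Data.Empty using (⊥-elim)
open import Data.Product using (_,_; _×_; proj₁; proj₂)
open import Data.Sum using (_⊎_; inj₁; inj₂)
open import Data.Nat
  using (ℕ; zero; suc; pred; _+_; _*_; _≤_; _<_; _≤′_; ≤′-refl; ≤′-step; z≤n; s≤s; z<s; _≟_; _<?_)
open import Data.Nat.Properties
open import Data.Nat.ListAction using (sum)
open import Data.Nat.Tactic.RingSolver using (solve-∀)
open import Algebra.Properties.CommutativeSemigroup +-commutativeSemigroup using (x∙yz≈y∙xz)
open import Data.List using (List; []; _∷_; length; filter; map; _++_; replicate; applyUpTo; upTo)
open import Data.List.Properties
  using (++-identityʳ; ++-assoc; length-++; length-map; length-filter; length-upTo;
         map-applyUpTo; map-upTo; filter-accept; filter-reject)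
open import Data.List.Relation.Unary.All using (All; []; _∷_)
import Data.List.Relation.Unary.All as All
import Data.List.Relation.Unary.All.Properties as AllP
open import Data.List.Relation.Unary.Unique.Propositional using (Unique; [])
open import Data.List.Relation.Unary.Unique.Propositional.Properties using (applyUpTo⁺₁)
open import Data.List.Relation.Binary.Permutation.Propositional
  using (_↭_; prep; ↭-reflexive; module PermutationReasoning)
open import Data.List.Relation.Binary.Permutation.Propositional.Properties
  using (↭-length; filter-↭; ++-comm; map⁺)
open import Relation.Binary using (tri<; tri≈; tri>)
open import Relation.Nullary using (yes; no; does)
open import Relation.Binary.PropositionalEquality

open import Defs

-- The entry of a word at a position, 0 beyond its end.  Words are read this
-- way so that a word of length n is the same thing as a function on positions
-- below n (see applyUpTo-nth).
nth : List ℕ → ℕ → ℕ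
nth []       _       = 0
nth (x ∷ xs) zero    = x
nth (x ∷ xs) (suc i) = nth xs i

nth-++ˡ : ∀ xs ys {i} → i < length xs → nth (xs ++ ys) i ≡ nth xs i
nth-++ˡ (x ∷ xs) ys {zero}  _         = refl
nth-++ˡ (x ∷ xs) ys {suc i} (s≤s i<n) = nth-++ˡ xs ys i<n

nth-++ʳ : ∀ xs ys j → nth (xs ++ ys) (length xs + j) ≡ nth ys j
nth-++ʳ []       ys j = refl
nth-++ʳ (x ∷ xs) ys j = nth-++ʳ xs ys j

nth-map : ∀ f xs {i} → i < length xs → nth (map f xs) i ≡ f (nth xs i)
nth-map f (x ∷ xs) {zero}  _         = refl
nth-map f (x ∷ xs) {suc i} (s≤s i<n) = nth-map f xs i<n

nth-applyUpTo : ∀ f {n i} → i < n → nth (applyUpTo f n) i ≡ f i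
nth-applyUpTo f {suc n} {zero}  _         = refl
nth-applyUpTo f {suc n} {suc i} (s≤s i<n) = nth-applyUpTo (f ∘ suc) i<n

applyUpTo-nth : ∀ xs {n} → length xs ≡ n → applyUpTo (nth xs) n ≡ xs
applyUpTo-nth []       refl = refl
applyUpTo-nth (x ∷ xs) refl = cong (x ∷_) (applyUpTo-nth xs refl)

count : ℕ → List ℕ → ℕ
count v xs = length (filter (_≟ v) xs)

count-hit : ∀ {v x xs} → x ≡ v → count v (x ∷ xs) ≡ suc (count v xs)
count-hit {v} x≡v = cong length (filter-accept (_≟ v) x≡v)

count-miss : ∀ {v x xs} → x ≢ v → count v (x ∷ xs) ≡ count v xs
count-miss {v} x≢v = cong length (filter-reject (_≟ v) x≢v)

count-map : ∀ {A : Set} (f : A → ℕ) v xs → length (filter (λ x → f x ≟ v) xs) ≡ count v (map f xs)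
count-map f v []       = refl
count-map f v (x ∷ xs) with does (f x ≟ v)
... | true  = cong suc (count-map f v xs)
... | false = count-map f v xs

count-↭ : ∀ v {xs ys} → xs ↭ ys → count v xs ≡ count v ys
count-↭ v p = ↭-length (filter-↭ (_≟ v) p)

marginal : ∀ {A : Set} (f : A → ℕ) {xs ws} → map f xs ↭ ws →
           ∀ v → length (filter (λ x → f x ≟ v) xs) ≡ count v ws
marginal f {xs} perm v = trans (count-map f v xs) (count-↭ v perm)

count-map-suc-0 : ∀ xs → count 0 (map suc xs) ≡ 0
count-map-suc-0 []       = refl
count-map-suc-0 (x ∷ xs) = count-map-suc-0 xs

count-map-suc : ∀ v xs → count (suc v) (map suc xs) ≡ count v xs
count-map-suc v []       = refl
count-map-suc v (x ∷ xs) with x ≟ v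
... | yes x≡v = begin
  count (suc v) (suc x ∷ map suc xs) ≡⟨ count-hit (cong suc x≡v) ⟩
  suc (count (suc v) (map suc xs))   ≡⟨ cong suc (count-map-suc v xs) ⟩
  suc (count v xs)                   ≡⟨ count-hit x≡v ⟨
  count v (x ∷ xs)                   ∎
  where open ≡-Reasoning
... | no x≢v = begin
  count (suc v) (suc x ∷ map suc xs) ≡⟨ count-miss (x≢v ∘ suc-injective) ⟩
  count (suc v) (map suc xs)         ≡⟨ count-map-suc v xs ⟩
  count v xs                         ≡⟨ count-miss x≢v ⟨
  count v (x ∷ xs)                   ∎
  where open ≡-Reasoning

-- Sparse words

Sparse : ℕ → List ℕ → Set
Sparse c w = ∀ {i j} → i + c ≤ j → j < length w → nth w i ≢ nth w j

shift : ℕ → List ℕ → List ℕ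
shift m w = replicate m 0 ++ map suc w

length-shift : ∀ m w → length (shift m w) ≡ m + length w
length-shift zero    w = length-map suc w
length-shift (suc m) w = cong suc (length-shift m w)

count-shift-0 : ∀ m w → count 0 (shift m w) ≡ m
count-shift-0 zero    w = count-map-suc-0 w
count-shift-0 (suc m) w = cong suc (count-shift-0 m w)

count-shift-suc : ∀ m w v → count (suc v) (shift m w) ≡ count v w
count-shift-suc zero    w v = count-map-suc v w
count-shift-suc (suc m) w v = count-shift-suc m w v

nth-shift-< : ∀ {m w i} → i < m → nth (shift m w) i ≡ 0
nth-shift-< {suc m} {i = zero}  _         = refl
nth-shift-< {suc m} {i = suc i} (s≤s i<m) = nth-shift-< i<m

nth-shift-≥ : ∀ m w {k} → k < length w → nth (shift m w) (m + k) ≡ suc (nth w k)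
nth-shift-≥ zero    w k<len = nth-map suc w k<len
nth-shift-≥ (suc m) w k<len = nth-shift-≥ m w k<len

shift-index : ∀ m w {k} → m + k < length (shift m w) → k < length w
shift-index m w {k} lt = +-cancelˡ-< m k (length w) (subst (m + k <_) (length-shift m w) lt)

-- Shifting a c-sparse word by at most c zeros keeps it c-sparse: two raised
-- letters compare as in w, and a zero is at distance c only from raised letters.
sparse-shift : ∀ {c} m w → m ≤ c → Sparse c w → Sparse c (shift m w)
sparse-shift {c} m w m≤c sparse {i} {j} i+c≤j j<len
  with j' , refl ← m≤n⇒∃[o]m+o≡n (≤-trans m≤c (≤-trans (m≤n+m c i) i+c≤j)) | i <? m
... | yes i<m = λ eq →
  0≢1+n (trans (sym (nth-shift-< i<m)) (trans eq (nth-shift-≥ m w (shift-index m w j<len))))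
... | no i≮m with i' , refl ← m≤n⇒∃[o]m+o≡n (≮⇒≥ i≮m) = λ eq →
  let j'<len  = shift-index m w j<len
      i'+c≤j' = +-cancelˡ-≤ m (i' + c) j' (subst (_≤ m + j') (+-assoc m i' c) i+c≤j)
      i'<len  = ≤-<-trans (≤-trans (m≤m+n i' c) i'+c≤j') j'<len
  in sparse i'+c≤j' j'<len
       (suc-injective (trans (sym (nth-shift-≥ m w i'<len)) (trans eq (nth-shift-≥ m w j'<len))))

-- Column words

-- colLen ks j: the length of column j of the diagram with row lengths ks.
-- For a partition α, colLen (parts α) is transpose α by definition.
colLen : List ℕ → ℕ → ℕ
colLen ks j = length (filter (j <?_) ks)

colLen-pred : ∀ ks j → colLen (map pred ks) j ≡ colLen ks (suc j)
colLen-pred []           j = refl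
colLen-pred (zero  ∷ ks) j = colLen-pred ks j
colLen-pred (suc k ∷ ks) j with does (j <? k)
... | true  = cong suc (colLen-pred ks j)
... | false = colLen-pred ks j

sum-split : ∀ ks → sum ks ≡ colLen ks 0 + sum (map pred ks)
sum-split []           = refl
sum-split (zero  ∷ ks) = sum-split ks
sum-split (suc k ∷ ks) =
  trans (cong (suc k +_) (sum-split ks)) (cong suc (x∙yz≈y∙xz k (colLen ks 0) (sum (map pred ks))))

-- colWord N ks lists the column index of every cell of the diagram with row
-- lengths ks, column by column; N is a bound on the row lengths that makes the
-- recursion (peel off the first column) structural.
colWord : ℕ → List ℕ → List ℕ
colWord zero    ks = []
colWord (suc N) ks = shift (colLen ks 0) (colWord N (map pred ks))

pred-bounded : ∀ {N ks} → All (_≤ suc N) ks → All (_≤ N) (map pred ks)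
pred-bounded = AllP.map⁺ ∘ All.map pred-mono-≤

sum-zeros : ∀ {ks} → All (_≤ 0) ks → sum ks ≡ 0
sum-zeros []           = refl
sum-zeros (z≤n ∷ ks≤0) = sum-zeros ks≤0

colLen-zeros : ∀ {ks} v → All (_≤ 0) ks → colLen ks v ≡ 0
colLen-zeros v []           = refl
colLen-zeros v (z≤n ∷ ks≤0) = colLen-zeros v ks≤0

length-colWord : ∀ N ks → All (_≤ N) ks → length (colWord N ks) ≡ sum ks
length-colWord zero    ks ks≤0 = sym (sum-zeros ks≤0)
length-colWord (suc N) ks ks≤N = begin
  length (shift (colLen ks 0) (colWord N (map pred ks)))
    ≡⟨ length-shift (colLen ks 0) (colWord N (map pred ks)) ⟩
  colLen ks 0 + length (colWord N (map pred ks))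
    ≡⟨ cong (colLen ks 0 +_) (length-colWord N (map pred ks) (pred-bounded ks≤N)) ⟩
  colLen ks 0 + sum (map pred ks)
    ≡⟨ sum-split ks ⟨
  sum ks ∎
  where open ≡-Reasoning

count-colWord : ∀ N ks → All (_≤ N) ks → ∀ v → count v (colWord N ks) ≡ colLen ks v
count-colWord zero    ks ks≤0 v       = sym (colLen-zeros v ks≤0)
count-colWord (suc N) ks ks≤N zero    = count-shift-0 (colLen ks 0) (colWord N (map pred ks))
count-colWord (suc N) ks ks≤N (suc v) = begin
  count (suc v) (shift (colLen ks 0) (colWord N (map pred ks)))
    ≡⟨ count-shift-suc (colLen ks 0) (colWord N (map pred ks)) v ⟩
  count v (colWord N (map pred ks))
    ≡⟨ count-colWord N (map pred ks) (pred-bounded ks≤N) v ⟩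
  colLen (map pred ks) v
    ≡⟨ colLen-pred ks v ⟩
  colLen ks (suc v) ∎
  where open ≡-Reasoning

-- With at most c rows every column has at most c cells, so the word is c-sparse.
sparse-colWord : ∀ {c} N ks → length ks ≤ c → Sparse c (colWord N ks)
sparse-colWord zero    ks _    _ ()
sparse-colWord (suc N) ks ks≤c =
  sparse-shift (colLen ks 0) _ (≤-trans (length-filter (0 <?_) ks) ks≤c)
    (sparse-colWord N (map pred ks) (subst (_≤ _) (sym (length-map pred ks)) ks≤c))

same-pile-gap : ∀ c r {t t'} → t < t' → r + c * t + c ≤ r + c * t'
same-pile-gap c r {t} {t'} t<t' = begin
  r + c * t + c   ≡⟨ regroup r c t ⟩
  r + c * suc t   ≤⟨ +-monoʳ-≤ r (*-monoʳ-≤ c t<t') ⟩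
  r + c * t'      ∎
  where
  open ≤-Reasoning
  regroup : ∀ r c t → r + c * t + c ≡ r + c * suc t
  regroup = solve-∀

digit-bound : ∀ c {r r' t t'} → r' < c → r + c * t < r' + c * t' + c → t ≤ suc t'
digit-bound c {r} {r'} {t} {t'} r'<c lt = ≤-pred (*-cancelˡ-< c t (2 + t') (begin-strict
  c * t            ≤⟨ m≤n+m (c * t) r ⟩
  r + c * t        <⟨ lt ⟩
  r' + c * t' + c  ≤⟨ +-monoˡ-≤ c (+-monoˡ-≤ (c * t') (<⇒≤ r'<c)) ⟩
  c + c * t' + c   ≡⟨ regroup c t' ⟩
  c * (2 + t')     ∎))
  where
  open ≤-Reasoning
  regroup : ∀ c t' → c + c * t' + c ≡ c * (2 + t')
  regroup = solve-∀

cross-gap : ∀ c {off len off' t t'} → c < len → off + len ≤ off' → t ≤ suc t' → off + t + c ≤ off' + t'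
cross-gap c {off} {len} {off'} {t} {t'} c<len front t≤1+t' = begin
  off + t + c         ≤⟨ +-monoˡ-≤ c (+-monoʳ-≤ off t≤1+t') ⟩
  off + suc t' + c    ≡⟨ regroup off t' c ⟩
  off + suc c + t'    ≤⟨ +-monoˡ-≤ t' (+-monoʳ-≤ off c<len) ⟩
  off + len + t'      ≤⟨ +-monoˡ-≤ t' front ⟩
  off' + t'           ∎
  where
  open ≤-Reasoning
  regroup : ∀ off t' c → off + suc t' + c ≡ off + suc c + t'
  regroup = solve-∀

-- Dealing into c = suc d piles

module Dealing (d : ℕ) where

  -- pile r xs: the entries of xs at positions r, r + c, r + 2c, … (for r ≤ d).
  pile : ∀ {A : Set} → ℕ → List A → List A
  pile r       []       = []
  pile zero    (x ∷ xs) = x ∷ pile d xs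
  pile (suc r) (x ∷ xs) = pile r xs

  deal : ∀ {A : Set} → ℕ → List A → List A
  deal zero    xs = []
  deal (suc k) xs = deal k xs ++ pile k xs

  deal-cons : ∀ {A : Set} k (x : A) xs → deal (suc k) (x ∷ xs) ≡ (x ∷ pile d xs) ++ deal k xs
  deal-cons zero    x xs = sym (++-identityʳ (x ∷ pile d xs))
  deal-cons (suc k) x xs =
    trans (cong (_++ pile k xs) (deal-cons k x xs)) (++-assoc (x ∷ pile d xs) (deal k xs) (pile k xs))

  deal-nil : ∀ {A : Set} k → deal {A} k [] ≡ []
  deal-nil zero    = refl
  deal-nil (suc k) = trans (++-identityʳ (deal k [])) (deal-nil k)

  deal-↭ : ∀ {A : Set} (xs : List A) → deal (suc d) xs ↭ xs
  deal-↭ []       = ↭-reflexive (deal-nil (suc d))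
  deal-↭ (x ∷ xs) = begin
    deal (suc d) (x ∷ xs)          ≡⟨ deal-cons d x xs ⟩
    x ∷ (pile d xs ++ deal d xs)   ↭⟨ prep x (++-comm (pile d xs) (deal d xs)) ⟩
    x ∷ deal (suc d) xs            ↭⟨ prep x (deal-↭ xs) ⟩
    x ∷ xs                         ∎
    where open PermutationReasoning

  nth-pile : ∀ {r} xs t → r ≤ d → nth (pile r xs) t ≡ nth xs (r + suc d * t)
  nth-pile []       t       _ = refl
  nth-pile {zero}  (x ∷ xs) zero    _ = cong (nth (x ∷ xs)) (sym (*-zeroʳ d))
  nth-pile {zero}  (x ∷ xs) (suc t) _ =
    trans (nth-pile xs t ≤-refl) (cong (nth (x ∷ xs)) (sym (*-suc (suc d) t)))
  nth-pile {suc r} (x ∷ xs) t       r≤d = nth-pile xs t (≤-trans (n≤1+n r) r≤d)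

  pile-bound : ∀ {A : Set} {r} (xs : List A) t → r ≤ d → t < length (pile r xs) → r + suc d * t < length xs
  pile-bound {r = zero}  (x ∷ xs) zero    _ _ = subst (_< suc (length xs)) (sym (*-zeroʳ d)) z<s
  pile-bound {r = zero}  (x ∷ xs) (suc t) _ (s≤s t<len) =
    subst (_< suc (length xs)) (sym (*-suc (suc d) t)) (s≤s (pile-bound xs t ≤-refl t<len))
  pile-bound {r = suc r} (x ∷ xs) t r≤d t<len = s≤s (pile-bound xs t (≤-trans (n≤1+n r) r≤d) t<len)

  pile-long : ∀ {A : Set} {r} (xs : List A) t → r ≤ d → r + suc d * t < length xs → t < length (pile r xs)
  pile-long {r = zero}  (x ∷ xs) zero    _ _ = z<s
  pile-long {r = zero}  (x ∷ xs) (suc t) _ lt =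
    s≤s (pile-long xs t ≤-refl (≤-pred (subst (_< suc (length xs)) (*-suc (suc d) t) lt)))
  pile-long {r = suc r} (x ∷ xs) t r≤d (s≤s lt) = pile-long xs t (≤-trans (n≤1+n r) r≤d) lt

  deal-grows : ∀ {A : Set} (xs : List A) {r r'} → r ≤′ r' → length (deal r xs) ≤ length (deal r' xs)
  deal-grows xs ≤′-refl               = ≤-refl
  deal-grows xs {r} (≤′-step {r'} le) = begin
    length (deal r xs)                          ≤⟨ deal-grows xs le ⟩
    length (deal r' xs)                         ≤⟨ m≤m+n _ _ ⟩
    length (deal r' xs) + length (pile r' xs)   ≡⟨ length-++ (deal r' xs) ⟨
    length (deal (suc r') xs)                   ∎
    where open ≤-Reasoning

  deal-front : ∀ {A : Set} (xs : List A) {r r'} → r < r' →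
               length (deal r xs) + length (pile r xs) ≤ length (deal r' xs)
  deal-front xs {r} r<r' = subst (_≤ _) (length-++ (deal r xs)) (deal-grows xs (≤⇒≤′ r<r'))

  record Location (k : ℕ) (xs : List ℕ) (p : ℕ) : Set where
    field
      pileNo offset : ℕ
      pileNo<k      : pileNo < k
      offset<length : offset < length (pile pileNo xs)
      position      : p ≡ length (deal pileNo xs) + offset
      entry         : nth (deal k xs) p ≡ nth (pile pileNo xs) offset

  locate : ∀ k xs {p} → p < length (deal k xs) → Location k xs p
  locate (suc k) xs {p} p<len with p <? length (deal k xs)
  ... | yes p<front = record
    { pileNo        = pileNo
    ; offset        = offset
    ; pileNo<k      = m<n⇒m<1+n pileNo<k
    ; offset<length = offset<length
    ; position      = position
    ; entry         = trans (nth-++ˡ (deal k xs) (pile k xs) p<front) entry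
    }
    where open Location (locate k xs p<front)
  ... | no p≮front with t , refl ← m≤n⇒∃[o]m+o≡n (≮⇒≥ p≮front) = record
    { pileNo        = k
    ; offset        = t
    ; pileNo<k      = ≤-refl
    ; offset<length = +-cancelˡ-< (length (deal k xs)) t (length (pile k xs))
                        (subst (length (deal k xs) + t <_) (length-++ (deal k xs)) p<len)
    ; position      = refl
    ; entry         = nth-++ʳ (deal k xs) (pile k xs) t
    }

  shuffle : ℕ → List ℕ
  shuffle n = deal (suc d) (upTo n)

  length-shuffle : ∀ n → length (shuffle n) ≡ n
  length-shuffle n = trans (↭-length (deal-↭ (upTo n))) (length-upTo n)

  pile-value : ∀ n {r t} → r ≤ d → t < length (pile r (upTo n)) →
               nth (pile r (upTo n)) t ≡ r + suc d * t × r + suc d * t < n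
  pile-value n {r} {t} r≤d t<len = trans (nth-pile (upTo n) t r≤d) (nth-applyUpTo id in-range) , in-range
    where
    in-range : r + suc d * t < n
    in-range = subst (r + suc d * t <_) (length-upTo n) (pile-bound (upTo n) t r≤d t<len)

  shuffle-bound : ∀ n {p} → p < n → nth (shuffle n) p < n
  shuffle-bound n {p} p<n
    with locate (suc d) (upTo n) (subst (p <_) (sym (length-shuffle n)) p<n)
  ... | record { pileNo<k = r<c ; offset<length = t<len ; entry = at-p }
    with pile-value n (≤-pred r<c) t<len
  ... | val , in-range = subst (_< n) (sym (trans at-p val)) in-range

  -- In the
  -- same pile the values differ by a multiple of c; across piles, two cards
  -- less than c apart are the end of one pile and the start of the next, so
  -- their values lie in different rows of the c-column grid.
  spread : ∀ {n p q} → d + suc d * suc d < n → p < q → q < n → q < p + suc d →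
           nth (shuffle n) p + suc d ≤ nth (shuffle n) q ⊎ nth (shuffle n) q + suc d ≤ nth (shuffle n) p
  spread {n} {p} {q} long p<q q<n near
    with locate (suc d) (upTo n) (subst (p <_) (sym (length-shuffle n)) (<-trans p<q q<n))
       | locate (suc d) (upTo n) (subst (q <_) (sym (length-shuffle n)) q<n)
  ... | record { pileNo = r ; offset = t ; pileNo<k = r<c ; offset<length = t<len ; position = refl ; entry = at-p }
      | record { pileNo = r' ; offset = t' ; pileNo<k = r'<c ; offset<length = t'<len ; position = refl ; entry = at-q }
      with pile-value n (≤-pred r<c) t<len | pile-value n (≤-pred r'<c) t'<len
  ... | val-p , _ | val-q , _ rewrite trans at-p val-p | trans at-q val-q with <-cmp r r'
  ... | tri≈ _ refl _ = inj₁ (same-pile-gap (suc d) r (+-cancelˡ-< (length (deal r (upTo n))) t t' p<q))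
  ... | tri< r<r' _ _ = inj₂ (≮⇒≥ λ lt → <-irrefl refl (<-≤-trans near
          (cross-gap (suc d) (long-pile r (≤-pred r<c)) (deal-front (upTo n) r<r') (digit-bound (suc d) {r} r'<c lt))))
    where
    long-pile : ∀ r → r ≤ d → suc d < length (pile r (upTo n))
    long-pile r r≤d = pile-long (upTo n) (suc d) r≤d
      (subst (r + suc d * suc d <_) (sym (length-upTo n)) (≤-<-trans (+-monoˡ-≤ _ r≤d) long))
  ... | tri> _ _ r'<r = ⊥-elim (<-irrefl refl (<-trans p<q (begin-strict
          length (deal r' (upTo n)) + t'                           <⟨ +-monoʳ-< _ t'<len ⟩
          length (deal r' (upTo n)) + length (pile r' (upTo n))    ≤⟨ deal-front (upTo n) r'<r ⟩
          length (deal r (upTo n))                                 ≤⟨ m≤m+n _ t ⟩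
          length (deal r (upTo n)) + t                             ∎)))
    where open ≤-Reasoning

-- The point set of three words

module Realisation (d : ℕ) where
  open Dealing d

  points : (wx wy wz : List ℕ) → ℕ → List Point
  points wx wy wz n = applyUpTo (λ p → nth wx (nth (shuffle n) p) , nth wy p , nth wz p) n

  x-values : ∀ wx wy wz {n} → length wx ≡ n → map px (points wx wy wz n) ↭ wx
  x-values wx wy wz {n} len = begin
    map px (points wx wy wz n)                    ≡⟨ map-applyUpTo _ px n ⟩
    applyUpTo (nth wx ∘ nth (shuffle n)) n        ≡⟨ map-applyUpTo (nth (shuffle n)) (nth wx) n ⟨
    map (nth wx) (applyUpTo (nth (shuffle n)) n)  ≡⟨ cong (map (nth wx)) (applyUpTo-nth (shuffle n) (length-shuffle n)) ⟩
    map (nth wx) (shuffle n)                      ↭⟨ map⁺ (nth wx) (deal-↭ (upTo n)) ⟩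
    map (nth wx) (upTo n)                         ≡⟨ map-upTo (nth wx) n ⟩
    applyUpTo (nth wx) n                          ≡⟨ applyUpTo-nth wx len ⟩
    wx                                            ∎
    where open PermutationReasoning

  y-values : ∀ wx wy wz {n} → length wy ≡ n → map py (points wx wy wz n) ≡ wy
  y-values wx wy wz {n} len = trans (map-applyUpTo _ py n) (applyUpTo-nth wy len)

  z-values : ∀ wx wy wz {n} → length wz ≡ n → map pz (points wx wy wz n) ≡ wz
  z-values wx wy wz {n} len = trans (map-applyUpTo _ pz n) (applyUpTo-nth wz len)

  -- Coinciding points p < q: the y-letters make q - p < c, so the shuffle
  -- spreads p and q at least c apart, where the x-letters must differ.
  points-unique : ∀ wx wy wz {n} → Sparse (suc d) wx → Sparse (suc d) wy →
                  length wx ≡ n → length wy ≡ n → d + suc d * suc d < n → Unique (points wx wy wz n)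
  points-unique wx wy wz {n} sparse-x sparse-y len-x len-y long =
    applyUpTo⁺₁ _ n λ {p} {q} p<q q<n same →
      let near   = ≰⇒> λ far → sparse-y far (subst (q <_) (sym len-y) q<n) (cong (proj₁ ∘ proj₂) same)
          x-same = cong proj₁ same
      in case spread long p<q q<n near of λ where
        (inj₁ gap) → sparse-x gap (subst (_ <_) (sym len-x) (shuffle-bound n q<n)) x-same
        (inj₂ gap) → sparse-x gap (subst (_ <_) (sym len-x) (shuffle-bound n (<-trans p<q q<n))) (sym x-same)

parts≤sum : ∀ ks → All (_≤ sum ks) ks
parts≤sum []       = []
parts≤sum (k ∷ ks) = m≤m+n k (sum ks) ∷ All.map (λ k'≤ → ≤-trans k'≤ (m≤n+m (sum ks) k)) (parts≤sum ks)

word : Partition → List ℕ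
word α = colWord ∣ α ∣ₚ (parts α)

length-word : ∀ α → length (word α) ≡ ∣ α ∣ₚ
length-word α = length-colWord ∣ α ∣ₚ (parts α) (parts≤sum (parts α))

count-word : ∀ α v → count v (word α) ≡ transpose α v
count-word α = count-colWord ∣ α ∣ₚ (parts α) (parts≤sum (parts α))

sparse-word : ∀ {c} α → ht α ≤ c → Sparse c (word α)
sparse-word α = sparse-colWord ∣ α ∣ₚ (parts α)

-- (c + 2) c ≤ n leaves every one of the c piles more than c cards.
enough-room : ∀ d {n} → (suc d + 2) * suc d ≤ n → d + suc d * suc d < n
enough-room d {n} big = ≤-trans (m≤m+n _ (suc d)) (≤-trans (≤-reflexive (expand d)) big)
  where
  expand : ∀ d → suc (d + suc d * suc d) + suc d ≡ (suc d + 2) * suc d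
  expand = solve-∀

lemma6p5 : (c : ℕ) (λ' μ π : Partition) →
    ht λ' ≤ c → ht μ ≤ c → ht π ≤ c →
    ∣ λ' ∣ₚ ≡ ∣ μ ∣ₚ → ∣ μ ∣ₚ ≡ ∣ π ∣ₚ →
    (c + 2) * c ≤ ∣ λ' ∣ₚ →
    tPositive λ' μ π
lemma6p5 zero (mkPartition [] _ _) (mkPartition [] _ _) (mkPartition [] _ _) _ _ _ _ _ _ =
  [] , [] , (λ _ → refl) , (λ _ → refl) , (λ _ → refl)
lemma6p5 zero (mkPartition (_ ∷ _) _ _) _ _ () _ _ _ _ _
lemma6p5 zero _ (mkPartition (_ ∷ _) _ _) _ _ () _ _ _ _
lemma6p5 zero _ _ (mkPartition (_ ∷ _) _ _) _ _ () _ _ _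
lemma6p5 (suc d) λ' μ π ht-λ ht-μ ht-π λ=μ μ=π big =
  P , points-unique (word λ') (word μ) (word π) (sparse-word λ' ht-λ) (sparse-word μ ht-μ) len-λ len-μ
        (enough-room d big) ,
  (λ i → trans (marginal px (x-values (word λ') (word μ) (word π) len-λ) i) (count-word λ' i)) ,
  (λ i → trans (marginal py (↭-reflexive (y-values (word λ') (word μ) (word π) len-μ)) i) (count-word μ i)) ,
  (λ i → trans (marginal pz (↭-reflexive (z-values (word λ') (word μ) (word π) len-π)) i) (count-word π i))
  where
  open Realisation d
  n : ℕ
  n = ∣ λ' ∣ₚ
  P : List Point
  P = points (word λ') (word μ) (word π) n
  len-λ : length (word λ') ≡ n
  len-λ = length-word λ'
  len-μ : length (word μ) ≡ n
  len-μ = trans (length-word μ) (sym λ=μ)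
  len-π : length (word π) ≡ n
  len-π = trans (length-word π) (sym (trans λ=μ μ=π))
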